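{- Let $G=(V,E)$ be a hedgegraph with connectivity $\lambda>0$ and hedgegraph polymatroid $f:2^E\to\mathbb{Z}_{\ge0}$. Then $k^*(f)\le\lambda$.
   Context: A hedgegraph $G=(V,E)$ consists of a finite vertex set $V$ and a finite set $E$ of hedges; each hedge is a set of hyperedges (subsets of $V$), the hyperedges within one hedge are pairwise vertex-disjoint, and no hyperedge belongs to two hedges. For $S\subseteq V$, $\delta(S)$ is the set of hedges containing a hyperedge $h$ with $h\cap S\ne\emptyset$ and $h\setminus S\ne\emptyset$; $\lambda=\min\{|\delta(S)|:\emptyset\ne S\subsetneq V\}$. For $A\subseteq E$, $\#\mathrm{Comps}(V,A)$ is the number of connected components of the hypergraph on $V$ formed by all hyperedges of hedges in $A$, and $f(A)=|V|-\#\mathrm{Comps}(V,A)$. The functional strength is $k^*(f)=\min_{A\subseteq E}\left\lfloor\frac{\sum_{e\in E}(f(A\cup\{e\})-f(A))}{f(E)-f(A)}\right\rfloor$ (with $0/0=+\infty$). -}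

module Defs where

open import Data.Nat using (ℕ; zero; suc; _+_; _∸_; _≤_; _<_; _/_; _<ᵇ_)
import Data.Nat as N
open import Data.Bool using (Bool; true; false; _∧_; _∨_; not; if_then_else_)
open import Data.Fin using (Fin; toℕ)
open import Data.Fin.Subset using (Subset; _∈_; _∪_; ⁅_⁆; ⊤)
open import Data.Vec using (Vec; []; _∷_)
import Data.Vec as V
open import Data.List using (List; []; _∷_; length; lookup; allFin; map; _++_)
open import Data.Bool.ListAction using (any)
open import Data.Nat.ListAction using (sum)
open import Data.Maybe using (Maybe; just; nothing)
open import Data.Empty using (⊥)
import Data.Unit as U
open import Relation.Binary.PropositionalEquality using (_≢_)

-- A hedgegraph: vertex set V = Fin n, hedge set E = Fin m.
-- Hedge i is a finite set of hyperedges (subsets of V), given as a list.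
record Hedgegraph : Set where
  field
    n : ℕ
    m : ℕ
    hedge : Fin m → List (Subset n)
    disjoint : ∀ i (j k : Fin (length (hedge i))) → j ≢ k →
               ∀ v → v ∈ lookup (hedge i) j → v ∈ lookup (hedge i) k → ⊥
    distinct : ∀ i i' → i ≢ i' → ∀ j k → lookup (hedge i) j ≢ lookup (hedge i') k

open Hedgegraph public

anyFin : ∀ {k} → (Fin k → Bool) → Bool
anyFin {k} p = any p (allFin k)

countFin : ∀ {k} → (Fin k → Bool) → ℕ
countFin {k} p = sum (map (λ i → if p i then 1 else 0) (allFin k))

crosses : ∀ {k} → Subset k → Subset k → Bool
crosses S h = anyFin (λ v → V.lookup h v ∧ V.lookup S v)
            ∧ anyFin (λ v → V.lookup h v ∧ not (V.lookup S v))

cutSize : (G : Hedgegraph) → Subset (n G) → ℕ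
cutSize G S = countFin (λ i → any (crosses S) (hedge G i))

adj : (G : Hedgegraph) → Subset (m G) → Fin (n G) → Fin (n G) → Bool
adj G A u v = anyFin (λ i → V.lookup A i ∧ any (λ h → V.lookup h u ∧ V.lookup h v) (hedge G i))

reach : (G : Hedgegraph) → Subset (m G) → ℕ → Fin (n G) → Fin (n G) → Bool
reach G A zero u v = toℕ u N.≡ᵇ toℕ v
reach G A (suc k) u v = reach G A k u v ∨ anyFin (λ w → reach G A k u w ∧ adj G A w v)

-- connected in the hypergraph (V, ⋃A): walks of length ≤ |V| suffice
connected : (G : Hedgegraph) → Subset (m G) → Fin (n G) → Fin (n G) → Bool
connected G A = reach G A (n G)

-- #Comps(V,A): number of vertices that are the least element of their component
numComps : (G : Hedgegraph) → Subset (m G) → ℕ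
numComps G A = countFin (λ v → not (anyFin (λ u → (toℕ u <ᵇ toℕ v) ∧ connected G A u v)))

f : (G : Hedgegraph) → Subset (m G) → ℕ
f G A = n G ∸ numComps G A

-- extended naturals: nothing = +∞
ℕ∞ : Set
ℕ∞ = Maybe ℕ

min∞ : ℕ∞ → ℕ∞ → ℕ∞
min∞ nothing y = y
min∞ (just x) nothing = just x
min∞ (just x) (just y) = just (N._⊓_ x y)

minimum∞ : List ℕ∞ → ℕ∞
minimum∞ [] = nothing
minimum∞ (x ∷ xs) = min∞ x (minimum∞ xs)

_≤∞_ : ℕ∞ → ℕ∞ → Set
_ ≤∞ nothing = U.⊤
nothing ≤∞ just _ = ⊥
just a ≤∞ just b = a ≤ b

Pos∞ : ℕ∞ → Set
Pos∞ nothing = U.⊤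
Pos∞ (just k) = 0 < k

allSubsets : ∀ k → List (Subset k)
allSubsets zero = [] ∷ []
allSubsets (suc k) = map (true ∷_) (allSubsets k) ++ map (false ∷_) (allSubsets k)

connectivity : Hedgegraph → ℕ∞
connectivity G = minimum∞ (map term (allSubsets (n G)))
  where
  term : Subset (n G) → ℕ∞
  term S = if anyFin (V.lookup S) ∧ anyFin (λ v → not (V.lookup S v))
           then just (cutSize G S) else nothing

-- floor(a / b) with a/0 = +∞
div∞ : ℕ → ℕ → ℕ∞
div∞ a zero = nothing
div∞ a (suc b) = just (a / suc b)

strengthRatio : (G : Hedgegraph) → Subset (m G) → ℕ∞
strengthRatio G A =
  div∞ (sum (map (λ e → f G (A ∪ ⁅ e ⁆) ∸ f G A) (allFin (m G))))
       (f G ⊤ ∸ f G A)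

kstar : Hedgegraph → ℕ∞
kstar G = minimum∞ (map (strengthRatio G) (allSubsets (m G)))

-- Let S attain λ and let A be the set of hedges outside δ(S). No component of (V, A)
-- meets both S and V ∖ S, whereas λ > 0 makes (V, E) connected; hence f(E) − f(A) ≥ 1.
-- Adding a hedge e to A raises f by nothing if e ∉ δ(S) and by at most f(E) − f(A)
-- otherwise, so the numerator of the ratio at A is at most λ (f(E) − f(A)).
module Submission where

open import Defs
open import Data.Nat using (ℕ; zero; suc; _+_; _*_; _∸_; _≤_; _<_; z≤n; s≤s; _≤′_; ≤′-refl; ≤′-step; _<ᵇ_)
open import Data.Nat.Properties
open import Data.Nat.DivMod using (/-monoˡ-≤; m*n/n≡m)
open import Data.Bool using (Bool; true; false; _∧_; not; if_then_else_; T)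
open import Data.Bool.Properties using (T?; T-∧; T-∨; T-≡)
import Data.Bool.Properties as Bool
open import Data.Unit using (tt)
open import Data.Empty using (⊥-elim)
open import Data.Product using (∃; _×_; _,_; proj₁; proj₂)
open import Data.Sum using (_⊎_; inj₁; inj₂)
import Data.Sum as Sum
open import Data.Maybe using (just; nothing)
open import Data.Fin using (Fin; toℕ; fromℕ<)
open import Data.Fin.Properties using (toℕ-injective; toℕ-fromℕ<; toℕ-inject; toℕ<n; any?; ¬∀⟶∃¬-smallest)
open import Data.Fin.Subset using (Subset; _∈_; _⊆_; _∪_; ⁅_⁆) renaming (⊤ to Full)
open import Data.Fin.Subset.Properties using (⊆⊤; ∈⊤; x∈⁅y⁆⇒x≡y; x∈p∪q⁻)
import Data.Vec as V
open import Data.Vec.Properties using (lookup∘tabulate; lookup⇒[]=; []=⇒lookup)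
open import Data.List using (List; []; _∷_; allFin; map; length)
open import Data.List.Properties using (length-tabulate)
import Data.List.Membership.Propositional as List
open import Data.List.Membership.Propositional using (lose; find)
open import Data.List.Membership.Propositional.Properties using (∈-allFin; ∈-map⁺; ∈-map⁻; ∈-++⁺ˡ; ∈-++⁺ʳ)
open import Data.List.Relation.Unary.Any using (here; there; satisfied)
open import Data.List.Relation.Unary.Any.Properties using (any⁺; any⁻)
open import Data.Bool.ListAction using (any)
open import Data.Nat.ListAction using (sum)
open import Function.Bundles using (Equivalence)
open import Function.Base using (_∘_)
open import Relation.Binary.PropositionalEquality
open import Relation.Nullary using (¬_; yes; no)
open import Relation.Unary using (Decidable)
open import Relation.Nullary.Decidable using (_×-dec_; ¬?)

open Equivalence using (to; from)

T-not⁺ : ∀ {x} → ¬ T x → T (not x)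
T-not⁺ {false} _ = tt
T-not⁺ {true} ¬t = ¬t tt

T-not⁻ : ∀ {x} → T (not x) → ¬ T x
T-not⁻ {false} _ ()

T-if : ∀ {A : Set} {b} {x y : A} → T b → (if b then x else y) ≡ x
T-if {b = true} _ = refl

¬T-if : ∀ {A : Set} {b} {x y : A} → ¬ T b → (if b then x else y) ≡ y
¬T-if {b = true} ¬t = ⊥-elim (¬t tt)
¬T-if {b = false} _ = refl

anyFin⁺ : ∀ {k} (p : Fin k → Bool) {i} → T (p i) → T (anyFin p)
anyFin⁺ p {i} t = any⁺ p (lose (∈-allFin i) t)

anyFin⁻ : ∀ {k} (p : Fin k → Bool) → T (anyFin p) → ∃ λ i → T (p i)
anyFin⁻ {k} p t = satisfied (any⁻ p (allFin k) t)

anyFin-mono : ∀ {k} (p q : Fin k → Bool) → (∀ {i} → T (p i) → T (q i)) → T (anyFin p) → T (anyFin q)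
anyFin-mono p q p⇒q t = let (i , pi) = anyFin⁻ p t in anyFin⁺ q (p⇒q pi)

_⊆ᵇ_ : ∀ {A : Set} → (A → Bool) → (A → Bool) → Set
p ⊆ᵇ q = ∀ {x} → T (p x) → T (q x)

⊆ᵇ⊎∃∖ : ∀ {k} (p q : Fin k → Bool) → p ⊆ᵇ q ⊎ ∃ λ i → T (p i) × ¬ T (q i)
⊆ᵇ⊎∃∖ p q with any? (λ i → T? (p i) ×-dec ¬? (T? (q i)))
... | yes new = inj₂ new
... | no ¬new = inj₁ included
  where
  included : p ⊆ᵇ q
  included {i} pi with T? (q i)
  ... | yes qi = qi
  ... | no ¬qi = ⊥-elim (¬new (i , pi , ¬qi))

∈⇒T-lookup : ∀ {k} {p : Subset k} {i} → i ∈ p → T (V.lookup p i)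
∈⇒T-lookup i∈p = from T-≡ ([]=⇒lookup i∈p)

T-lookup⇒∈ : ∀ {k} {p : Subset k} {i} → T (V.lookup p i) → i ∈ p
T-lookup⇒∈ {p = p} {i} t = lookup⇒[]= i p (to T-≡ t)

T-tabulate⁺ : ∀ {k} (p : Fin k → Bool) {i} → T (p i) → T (V.lookup (V.tabulate p) i)
T-tabulate⁺ p {i} = subst T (sym (lookup∘tabulate p i))

T-tabulate⁻ : ∀ {k} (p : Fin k → Bool) {i} → T (V.lookup (V.tabulate p) i) → T (p i)
T-tabulate⁻ p {i} = subst T (lookup∘tabulate p i)

least-counterexample : ∀ {k} (P : Fin k → Set) → Decidable P → ¬ (∀ i → P i) →
                       ∃ λ w → ¬ P w × (∀ u → toℕ u < toℕ w → P u)
least-counterexample {k} P P? ¬∀P with ¬∀⟶∃¬-smallest k P P? ¬∀P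
... | w , ¬Pw , below = w , ¬Pw , λ u u<w →
  subst P (toℕ-injective (trans (toℕ-inject _) (toℕ-fromℕ< u<w))) (below (fromℕ< u<w))

count : ∀ {A : Set} → (A → Bool) → List A → ℕ
count p xs = sum (map (λ x → if p x then 1 else 0) xs)

if-mono : ∀ {a b} → (T a → T b) → (if a then 1 else 0) ≤ (if b then 1 else 0)
if-mono {false} _ = z≤n
if-mono {true} {true} _ = ≤-refl
if-mono {true} {false} a⇒b = ⊥-elim (a⇒b tt)

count-mono : ∀ {A : Set} {p q : A → Bool} → p ⊆ᵇ q → ∀ xs → count p xs ≤ count q xs
count-mono p⊆q [] = z≤n
count-mono p⊆q (x ∷ xs) = +-mono-≤ (if-mono p⊆q) (count-mono p⊆q xs)

count-mono-< : ∀ {A : Set} {p q : A → Bool} → p ⊆ᵇ q → ∀ {x} xs → x List.∈ xs →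
               T (q x) → ¬ T (p x) → count p xs < count q xs
count-mono-< p⊆q (x ∷ xs) (here refl) qx ¬px
  rewrite T-if {x = 1} {y = 0} qx | ¬T-if {x = 1} {y = 0} ¬px = s≤s (count-mono p⊆q xs)
count-mono-< p⊆q (x ∷ xs) (there x∈xs) qx ¬px =
  +-mono-≤-< (if-mono p⊆q) (count-mono-< p⊆q xs x∈xs qx ¬px)

count≤length : ∀ {A : Set} (p : A → Bool) xs → count p xs ≤ length xs
count≤length p [] = z≤n
count≤length p (x ∷ xs) with p x
... | true = s≤s (count≤length p xs)
... | false = m≤n⇒m≤1+n (count≤length p xs)

count-none : ∀ {A : Set} {p : A → Bool} → (∀ x → ¬ T (p x)) → ∀ xs → count p xs ≡ 0
count-none ¬p [] = refl
count-none ¬p (x ∷ xs) rewrite ¬T-if {x = 1} {y = 0} (¬p x) = count-none ¬p xs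

countFin≤ : ∀ {k} (p : Fin k → Bool) → countFin p ≤ k
countFin≤ {k} p = ≤-trans (count≤length p (allFin k)) (≤-reflexive (length-tabulate {n = k} (λ i → i)))

*-if : ∀ d b → d * (if b then 1 else 0) ≡ (if b then d else 0)
*-if d true = *-identityʳ d
*-if d false = *-zeroʳ d

sum≤*count : ∀ {A : Set} {g : A → ℕ} {p : A → Bool} d → (∀ x → g x ≤ (if p x then d else 0)) →
             ∀ xs → sum (map g xs) ≤ d * count p xs
sum≤*count d g≤ [] = z≤n
sum≤*count {g = g} {p} d g≤ (x ∷ xs) = begin
  g x + sum (map g xs)                                  ≤⟨ +-mono-≤ (g≤ x) (sum≤*count d g≤ xs) ⟩
  (if p x then d else 0) + d * count p xs               ≡⟨ cong (_+ d * count p xs) (*-if d (p x)) ⟨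
  d * (if p x then 1 else 0) + d * count p xs           ≡⟨ *-distribˡ-+ d (if p x then 1 else 0) (count p xs) ⟨
  d * count p (x ∷ xs)                                  ∎
  where open ≤-Reasoning

≤∞-trans : ∀ {x y z} → x ≤∞ y → y ≤∞ z → x ≤∞ z
≤∞-trans {z = nothing} _ _ = tt
≤∞-trans {just _} {just _} {just _} x≤y y≤z = ≤-trans x≤y y≤z
≤∞-trans {nothing} {just _} {just _} () _
≤∞-trans {_} {nothing} {just _} _ ()

min∞-≤ˡ : ∀ x y → min∞ x y ≤∞ x
min∞-≤ˡ nothing y = tt
min∞-≤ˡ (just a) nothing = ≤-refl
min∞-≤ˡ (just a) (just b) = m⊓n≤m a b

min∞-≤ʳ : ∀ x y → min∞ x y ≤∞ y
min∞-≤ʳ x nothing = tt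
min∞-≤ʳ nothing (just b) = ≤-refl
min∞-≤ʳ (just a) (just b) = m⊓n≤n a b

min∞-sel : ∀ x y → min∞ x y ≡ x ⊎ min∞ x y ≡ y
min∞-sel nothing y = inj₂ refl
min∞-sel (just a) nothing = inj₁ refl
min∞-sel (just a) (just b) = Sum.map (cong just) (cong just) (⊓-sel a b)

minimum∞-≤ : ∀ {x} xs → x List.∈ xs → minimum∞ xs ≤∞ x
minimum∞-≤ (x ∷ xs) (here refl) = min∞-≤ˡ x (minimum∞ xs)
minimum∞-≤ (y ∷ xs) (there x∈xs) = ≤∞-trans (min∞-≤ʳ y (minimum∞ xs)) (minimum∞-≤ xs x∈xs)

minimum∞-attained : ∀ xs → minimum∞ xs ≡ nothing ⊎ minimum∞ xs List.∈ xs
minimum∞-attained [] = inj₁ refl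
minimum∞-attained (x ∷ xs) with min∞-sel x (minimum∞ xs)
... | inj₁ ≡x = inj₂ (here ≡x)
... | inj₂ ≡min with minimum∞-attained xs
...   | inj₁ none = inj₁ (trans ≡min none)
...   | inj₂ min∈xs = inj₂ (there (subst (List._∈ xs) (sym ≡min) min∈xs))

Pos∞⇒≰∞0 : ∀ {x} → Pos∞ x → ¬ (x ≤∞ just 0)
Pos∞⇒≰∞0 {just a} 0<a a≤0 = <⇒≱ 0<a a≤0

div∞-≤ : ∀ s d l → 0 < d → s ≤ l * d → div∞ s d ≤∞ just l
div∞-≤ s (suc d) l _ s≤ld = ≤-trans (/-monoˡ-≤ (suc d) s≤ld) (≤-reflexive (m*n/n≡m l (suc d)))

allSubsets-complete : ∀ {k} (S : Subset k) → S List.∈ allSubsets k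
allSubsets-complete V.[] = here refl
allSubsets-complete (true V.∷ S) = ∈-++⁺ˡ (∈-map⁺ (true V.∷_) (allSubsets-complete S))
allSubsets-complete {suc k} (false V.∷ S) =
  ∈-++⁺ʳ (map (true V.∷_) (allSubsets k)) (∈-map⁺ (false V.∷_) (allSubsets-complete S))

module Stabilisation {k} (P : ℕ → Fin k → Bool)
                     (P-grow : ∀ j → P j ⊆ᵇ P (suc j))
                     (P-step : ∀ {i j} → P i ⊆ᵇ P j → P (suc i) ⊆ᵇ P (suc j)) where

  P-mono : ∀ {i j} → i ≤ j → P i ⊆ᵇ P j
  P-mono i≤j = mono′ (≤⇒≤′ i≤j)
    where
    mono′ : ∀ {i j} → i ≤′ j → P i ⊆ᵇ P j
    mono′ ≤′-refl t = t
    mono′ (≤′-step i≤′j) t = P-grow _ (mono′ i≤′j t)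

  Stable : ℕ → Set
  Stable j = P (suc j) ⊆ᵇ P j

  stable-absorbs : ∀ {j} → Stable j → ∀ i → P i ⊆ᵇ P j
  stable-absorbs st zero = P-mono z≤n
  stable-absorbs st (suc i) t = st (P-step (stable-absorbs st i) t)

  stable-or-large : ∀ {v} → T (P 0 v) → ∀ j → (∃ λ i → i ≤ j × Stable i) ⊎ suc j ≤ countFin (P j)
  stable-or-large {v} P0v zero =
    inj₂ (≤-trans (s≤s z≤n) (count-mono-< {p = λ _ → false} (λ ()) (allFin k) (∈-allFin v) P0v (λ ())))
  stable-or-large P0v (suc j) with stable-or-large P0v j
  ... | inj₁ (i , i≤j , st) = inj₁ (i , m≤n⇒m≤1+n i≤j , st)
  ... | inj₂ large with ⊆ᵇ⊎∃∖ (P (suc j)) (P j)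
  ...   | inj₁ st = inj₁ (j , n≤1+n j , st)
  ...   | inj₂ (v , new , ¬old) =
    inj₂ (<-≤-trans (s≤s large) (count-mono-< (P-grow j) (allFin k) (∈-allFin v) new ¬old))

  -- A strictly increasing chain of subsets of Fin k starting nonempty has at most k steps.
  stabilises : ∀ {v} → T (P 0 v) → Stable k
  stabilises P0v with stable-or-large P0v k
  ... | inj₁ (i , i≤k , st) = λ t → P-mono i≤k (stable-absorbs st (suc k) t)
  ... | inj₂ large = ⊥-elim (<⇒≱ large (countFin≤ (P k)))

straddling-crosses : ∀ {k} (S h : Subset k) {u v} → T (V.lookup h u) → T (V.lookup h v) →
                     V.lookup S u ≢ V.lookup S v → T (crosses S h)
straddling-crosses S h {u} {v} hu hv S-differs with V.lookup S u in Su | V.lookup S v in Sv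
... | true  | true  = ⊥-elim (S-differs refl)
... | false | false = ⊥-elim (S-differs refl)
... | true  | false = from T-∧ (anyFin⁺ _ {u} (from T-∧ (hu , from T-≡ Su)) ,
                                 anyFin⁺ _ {v} (from T-∧ (hv , T-not⁺ (subst T Sv))))
... | false | true  = from T-∧ (anyFin⁺ _ {v} (from T-∧ (hv , from T-≡ Sv)) ,
                                 anyFin⁺ _ {u} (from T-∧ (hu , T-not⁺ (subst T Su))))

crosses⁻ : ∀ {k} (S h : Subset k) → T (crosses S h) →
           ∃ λ u → ∃ λ v → T (V.lookup h u) × T (V.lookup S u) × T (V.lookup h v) × ¬ T (V.lookup S v)
crosses⁻ S h cr =
  let inside , outside = to (T-∧ {anyFin (λ v → V.lookup h v ∧ V.lookup S v)}) cr
      u , hu∧Su = anyFin⁻ (λ v → V.lookup h v ∧ V.lookup S v) inside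
      v , hv∧¬Sv = anyFin⁻ (λ v → V.lookup h v ∧ not (V.lookup S v)) outside
      hu , Su = to (T-∧ {V.lookup h u}) hu∧Su
      hv , ¬Sv = to (T-∧ {V.lookup h v}) hv∧¬Sv
  in u , v , hu , Su , hv , T-not⁻ ¬Sv

module _ (G : Hedgegraph) where

  Crossing : Subset (n G) → Fin (m G) → Bool
  Crossing S i = any (crosses S) (hedge G i)

  isComponentMin : Subset (m G) → Fin (n G) → Bool
  isComponentMin A v = not (anyFin (λ u → (toℕ u <ᵇ toℕ v) ∧ connected G A u v))

  adj-mono : ∀ {A B} → A ⊆ B → ∀ {u v} → T (adj G A u v) → T (adj G B u v)
  adj-mono A⊆B = anyFin-mono {m G} _ _ λ t → let (i∈A , h) = to T-∧ t in
    from T-∧ (∈⇒T-lookup (A⊆B (T-lookup⇒∈ i∈A)) , h)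

  reach-mono : ∀ {A B} → A ⊆ B → ∀ j {u v} → T (reach G A j u v) → T (reach G B j u v)
  reach-mono A⊆B zero t = t
  reach-mono A⊆B (suc j) t with to T-∨ t
  ... | inj₁ r = from T-∨ (inj₁ (reach-mono A⊆B j r))
  ... | inj₂ s = from T-∨ (inj₂ (anyFin-mono {n G} _ _ (λ t → let (r , a) = to T-∧ t in
                   from T-∧ (reach-mono A⊆B j r , adj-mono A⊆B a)) s))

  isComponentMin-antimono : ∀ {A B} → A ⊆ B → isComponentMin B ⊆ᵇ isComponentMin A
  isComponentMin-antimono A⊆B root = T-not⁺ λ t → T-not⁻ root (anyFin-mono {n G} _ _
    (λ s → let (u<v , conn) = to T-∧ s in from T-∧ (u<v , reach-mono A⊆B (n G) conn)) t)

  numComps≤n : ∀ A → numComps G A ≤ n G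
  numComps≤n A = countFin≤ (isComponentMin A)

  numComps-antimono : ∀ {A B} → A ⊆ B → numComps G B ≤ numComps G A
  numComps-antimono A⊆B = count-mono (isComponentMin-antimono A⊆B) (allFin (n G))

  f-mono : ∀ {A B} → A ⊆ B → f G A ≤ f G B
  f-mono A⊆B = ∸-monoʳ-≤ (n G) (numComps-antimono A⊆B)

  f-mono-< : ∀ {A B} → A ⊆ B → ∀ {w} → T (isComponentMin A w) → ¬ T (isComponentMin B w) → f G A < f G B
  f-mono-< {A} A⊆B {w} rootA ¬rootB = ∸-monoʳ-<
    (count-mono-< (isComponentMin-antimono A⊆B) (allFin (n G)) (∈-allFin w) rootA ¬rootB) (numComps≤n A)

  reach-extend : ∀ {A} j {u v x} → T (reach G A j u v) → T (adj G A v x) → T (reach G A (suc j) u x)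
  reach-extend {A} j {u} {v} {x} uv vx =
    from (T-∨ {reach G A j u x}) (inj₂ (anyFin⁺ (λ w → reach G A j u w ∧ adj G A w x) {v} (from T-∧ (uv , vx))))

  module _ (A : Subset (m G)) (u : Fin (n G)) where

    private
      reach-grow : ∀ j → reach G A j u ⊆ᵇ reach G A (suc j) u
      reach-grow j t = from T-∨ (inj₁ t)

      reach-step : ∀ {i j} → reach G A i u ⊆ᵇ reach G A j u → reach G A (suc i) u ⊆ᵇ reach G A (suc j) u
      reach-step i⊆j t with to T-∨ t
      ... | inj₁ r = from T-∨ (inj₁ (i⊆j r))
      ... | inj₂ s = from T-∨ (inj₂ (anyFin-mono {n G} _ _ (λ t → let (r , a) = to T-∧ t in
                       from T-∧ (i⊆j r , a)) s))

      open Stabilisation (λ j → reach G A j u) reach-grow (λ {i} {j} → reach-step {i} {j})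

      reach-zero : T (reach G A 0 u u)
      reach-zero = ≡⇒≡ᵇ (toℕ u) (toℕ u) refl

    connected-refl : T (connected G A u u)
    connected-refl = P-mono {0} {n G} z≤n reach-zero

    connected-step : ∀ {v x} → T (connected G A u v) → T (adj G A v x) → T (connected G A u x)
    connected-step uv vx = stabilises reach-zero (reach-extend (n G) uv vx)

  adj⁺ : ∀ {A i h u v} → i ∈ A → h List.∈ hedge G i → T (V.lookup h u) → T (V.lookup h v) → T (adj G A u v)
  adj⁺ {A} {i} {h} {u} {v} i∈A h∈i hu hv =
    anyFin⁺ (λ i → V.lookup A i ∧ any (λ h → V.lookup h u ∧ V.lookup h v) (hedge G i)) {i}
      (from T-∧ (∈⇒T-lookup i∈A , any⁺ _ (lose h∈i (from T-∧ (hu , hv)))))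

  adj⁻ : ∀ {A u v} → T (adj G A u v) →
         ∃ λ i → ∃ λ h → i ∈ A × h List.∈ hedge G i × T (V.lookup h u) × T (V.lookup h v)
  adj⁻ {A} {u} {v} t =
    let i , s = anyFin⁻ (λ i → V.lookup A i ∧ any (λ h → V.lookup h u ∧ V.lookup h v) (hedge G i)) t
        i∈A , edge = to (T-∧ {V.lookup A i}) s
        h , h∈i , huv = find (any⁻ _ (hedge G i) edge)
        hu , hv = to (T-∧ {V.lookup h u}) huv
    in i , h , T-lookup⇒∈ i∈A , h∈i , hu , hv

  adj-within-side : ∀ {A} S → (∀ {i} → i ∈ A → ¬ T (Crossing S i)) →
                    ∀ {u v} → T (adj G A u v) → V.lookup S u ≡ V.lookup S v
  adj-within-side S uncut {u} {v} t with adj⁻ t | V.lookup S u Bool.≟ V.lookup S v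
  ... | _ | yes same = same
  ... | i , h , i∈A , h∈i , hu , hv | no differs =
    ⊥-elim (uncut i∈A (any⁺ (crosses S) (lose h∈i (straddling-crosses S h hu hv differs))))

  reach-within-side : ∀ {A} S → (∀ {i} → i ∈ A → ¬ T (Crossing S i)) →
                      ∀ j {u v} → T (reach G A j u v) → V.lookup S u ≡ V.lookup S v
  reach-within-side S uncut zero {u} {v} t = cong (V.lookup S) (toℕ-injective (≡ᵇ⇒≡ (toℕ u) (toℕ v) t))
  reach-within-side {A} S uncut (suc j) {u} {v} t with to (T-∨ {reach G A j u v}) t
  ... | inj₁ r = reach-within-side S uncut j r
  ... | inj₂ s =
    let x , s′ = anyFin⁻ (λ x → reach G A j u x ∧ adj G A x v) s
        r , a = to (T-∧ {reach G A j u x}) s′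
    in trans (reach-within-side S uncut j r) (adj-within-side S uncut a)

  closed⇒cutSize≡0 : ∀ S → (∀ {u v} → T (V.lookup S u) → T (adj G Full u v) → T (V.lookup S v)) →
                     cutSize G S ≡ 0
  closed⇒cutSize≡0 S closed = count-none ¬crossing (allFin (m G))
    where
    ¬crossing : ∀ i → ¬ T (Crossing S i)
    ¬crossing i c =
      let h , h∈i , cr = find (any⁻ (crosses S) (hedge G i) c)
          u , v , hu , Su , hv , ¬Sv = crosses⁻ S h cr
      in ¬Sv (closed Su (adj⁺ ∈⊤ h∈i hu hv))

nontrivial : ∀ {k} → Subset k → Bool
nontrivial S = anyFin (V.lookup S) ∧ anyFin (λ v → not (V.lookup S v))

module _ (G : Hedgegraph) where

  private
    cutTerm : Subset (n G) → ℕ∞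
    cutTerm S = if nontrivial S then just (cutSize G S) else nothing

  connectivity-≤-cutSize : ∀ {S} → T (nontrivial S) → connectivity G ≤∞ just (cutSize G S)
  connectivity-≤-cutSize {S} nt = subst (connectivity G ≤∞_) (T-if nt)
    (minimum∞-≤ (map cutTerm (allSubsets (n G))) (∈-map⁺ cutTerm (allSubsets-complete S)))

  connectivity-attained : connectivity G ≡ nothing ⊎
                          ∃ λ S → T (nontrivial S) × connectivity G ≡ just (cutSize G S)
  connectivity-attained with minimum∞-attained (map cutTerm (allSubsets (n G)))
  ... | inj₁ none = inj₁ none
  ... | inj₂ attained with ∈-map⁻ cutTerm attained
  ...   | S , _ , ≡term with T? (nontrivial S)
  ...     | yes nt = inj₂ (S , nt , trans ≡term (T-if nt))
  ...     | no ¬nt = inj₁ (trans ≡term (¬T-if ¬nt))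

  -- The component of u in (V, E) has empty cut, so it must be all of V when λ > 0.
  connected-full : Pos∞ (connectivity G) → ∀ u v → T (connected G Full u v)
  connected-full pos u v with T? (connected G Full u v)
  ... | yes uv = uv
  ... | no ¬uv = ⊥-elim (Pos∞⇒≰∞0 pos
    (subst (λ c → connectivity G ≤∞ just c) cut≡0 (connectivity-≤-cutSize {C} nt)))
    where
    C : Subset (n G)
    C = V.tabulate (connected G Full u)

    closed : ∀ {x y} → T (V.lookup C x) → T (adj G Full x y) → T (V.lookup C y)
    closed x∈C xy = T-tabulate⁺ (connected G Full u)
      (connected-step G Full u (T-tabulate⁻ (connected G Full u) x∈C) xy)

    cut≡0 : cutSize G C ≡ 0
    cut≡0 = closed⇒cutSize≡0 G C closed

    nt : T (nontrivial C)
    nt = from T-∧ (anyFin⁺ (V.lookup C) (T-tabulate⁺ (connected G Full u) (connected-refl G Full u)) ,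
                   anyFin⁺ (λ x → not (V.lookup C x)) (T-not⁺ (¬uv ∘ T-tabulate⁻ (connected G Full u))))

module MinimumCut (G : Hedgegraph) (pos : Pos∞ (connectivity G))
                  (S : Subset (n G)) (S-nontrivial : T (nontrivial S)) where

  side : Fin (n G) → Bool
  side = V.lookup S

  Uncut : Subset (m G)
  Uncut = V.tabulate (λ i → not (Crossing G S i))

  ∈Uncut⇒¬Crossing : ∀ {i} → i ∈ Uncut → ¬ T (Crossing G S i)
  ∈Uncut⇒¬Crossing i∈ = T-not⁻ (T-tabulate⁻ (λ i → not (Crossing G S i)) (∈⇒T-lookup i∈))

  ¬Crossing⇒∈Uncut : ∀ {i} → ¬ T (Crossing G S i) → i ∈ Uncut
  ¬Crossing⇒∈Uncut ¬c = T-lookup⇒∈ (T-tabulate⁺ (λ i → not (Crossing G S i)) (T-not⁺ ¬c))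

  private
    a∈S : ∃ λ a → T (side a)
    a∈S = anyFin⁻ side (proj₁ (to (T-∧ {anyFin side}) S-nontrivial))

    b∉S : ∃ λ b → T (not (side b))
    b∉S = anyFin⁻ (λ b → not (side b)) (proj₂ (to (T-∧ {anyFin side}) S-nontrivial))

    n>0 : 0 < n G
    n>0 = ≤-<-trans z≤n (toℕ<n (proj₁ a∈S))

  v₀ : Fin (n G)
  v₀ = fromℕ< n>0

  private
    opposite-side-exists : ¬ (∀ v → side v ≡ side v₀)
    opposite-side-exists same = T-not⁻ (proj₂ b∉S)
      (subst T (trans (same (proj₁ a∈S)) (sym (same (proj₁ b∉S)))) (proj₂ a∈S))

    least-opposite : ∃ λ w → side w ≢ side v₀ × (∀ u → toℕ u < toℕ w → side u ≡ side v₀)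
    least-opposite = least-counterexample (λ v → side v ≡ side v₀) (λ v → side v Bool.≟ side v₀)
                                          opposite-side-exists

  -- The least vertex of its component in (V, Uncut), but not in the connected (V, E).
  w : Fin (n G)
  w = proj₁ least-opposite

  w-opposite : side w ≢ side v₀
  w-opposite = proj₁ (proj₂ least-opposite)

  below-w-same-side : ∀ u → toℕ u < toℕ w → side u ≡ side v₀
  below-w-same-side = proj₂ (proj₂ least-opposite)

  v₀<w : toℕ v₀ < toℕ w
  v₀<w = subst (_< toℕ w) (sym (toℕ-fromℕ< n>0))
    (n≢0⇒n>0 λ w≡0 → w-opposite (cong side (toℕ-injective (trans w≡0 (sym (toℕ-fromℕ< n>0))))))

  w-isComponentMin-Uncut : T (isComponentMin G Uncut w)
  w-isComponentMin-Uncut = T-not⁺ λ t →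
    let u , s = anyFin⁻ (λ u → (toℕ u <ᵇ toℕ w) ∧ connected G Uncut u w) t
        u<w , uw = to (T-∧ {toℕ u <ᵇ toℕ w}) s
    in w-opposite (trans (sym (reach-within-side G S ∈Uncut⇒¬Crossing (n G) uw))
                         (below-w-same-side u (<ᵇ⇒< (toℕ u) (toℕ w) u<w)))

  w-¬isComponentMin-Full : ¬ T (isComponentMin G Full w)
  w-¬isComponentMin-Full root = T-not⁻ root
    (anyFin⁺ (λ u → (toℕ u <ᵇ toℕ w) ∧ connected G Full u w) {v₀}
      (from T-∧ (<⇒<ᵇ v₀<w , connected-full G pos v₀ w)))

  gap : ℕ
  gap = f G Full ∸ f G Uncut

  gap-positive : 0 < gap
  gap-positive = m<n⇒0<n∸m (f-mono-< G ⊆⊤ w-isComponentMin-Uncut w-¬isComponentMin-Full)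

  marginal-≤ : ∀ e → f G (Uncut ∪ ⁅ e ⁆) ∸ f G Uncut ≤ (if Crossing G S e then gap else 0)
  marginal-≤ e with T? (Crossing G S e)
  ... | yes c rewrite T-if {x = gap} {y = 0} c = ∸-monoˡ-≤ (f G Uncut) (f-mono G ⊆⊤)
  ... | no ¬c rewrite ¬T-if {x = gap} {y = 0} ¬c = ≤-reflexive (m≤n⇒m∸n≡0 (f-mono G absorbed))
    where
    absorbed : Uncut ∪ ⁅ e ⁆ ⊆ Uncut
    absorbed x∈ with x∈p∪q⁻ Uncut ⁅ e ⁆ x∈
    ... | inj₁ x∈Uncut = x∈Uncut
    ... | inj₂ x∈⁅e⁆ rewrite x∈⁅y⁆⇒x≡y e x∈⁅e⁆ = ¬Crossing⇒∈Uncut ¬c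

  kstar-≤-cutSize : kstar G ≤∞ just (cutSize G S)
  kstar-≤-cutSize = ≤∞-trans
    (minimum∞-≤ (map (strengthRatio G) (allSubsets (m G)))
      (∈-map⁺ (strengthRatio G) (allSubsets-complete Uncut)))
    (div∞-≤ _ gap (cutSize G S) gap-positive
      (≤-trans (sum≤*count gap marginal-≤ (allFin (m G))) (≤-reflexive (*-comm gap (cutSize G S)))))

lemma4p3 : (G : Hedgegraph) → Pos∞ (connectivity G) → kstar G ≤∞ connectivity G
lemma4p3 G pos with connectivity-attained G
... | inj₁ none = subst (kstar G ≤∞_) (sym none) tt
... | inj₂ (S , nt , ≡cut) = subst (kstar G ≤∞_) (sym ≡cut) (MinimumCut.kstar-≤-cutSize G pos S nt)
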